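{- Let $c$ be $0$ or a prime, $k\ge 3$, $\Gamma$ a graph on a finite set $V$, and $\gamma=[\alpha_{k,\Gamma}]^{\mathrm{Sol}_{k,1}^c}$. If $\vec{u},\vec{v}\in V^{k-1}$ satisfy $\mathrm{pr}_{k-1}\gamma(\vec{u})=\mathrm{pr}_{k-1}\gamma(\vec{v})$, then no first-order formula with at most $k-1$ variables distinguishes $(\mathfrak{A}_\Gamma,\vec{z}\mapsto\vec{u})$ from $(\mathfrak{A}_\Gamma,\vec{z}\mapsto\vec{v})$. In addition, if $c=0$, no $\mathcal{C}_{k-1}$-formula distinguishes $(\mathfrak{A}_\Gamma,\vec{z}\mapsto\vec{u})$ from $(\mathfrak{A}_\Gamma,\vec{z}\mapsto\vec{v})$.
   Context: A graph $\Gamma$ on $V$ is a finite relational structure $\mathfrak{A}_\Gamma$ with universe $V$ over a vocabulary of binary relation symbols. $\alpha_{k,\Gamma}$ is the labelled partition of $V^k$ into atomic types: $\alpha_{k,\Gamma}(\vec{u})=\alpha_{k,\Gamma}(\vec{w})$ iff $u_i\mapsto w_i$ ($i\in[k]$) is a well-defined bijection that is an isomorphism between the induced substructures. For $t\le k$, $\mathrm{pr}_t\gamma(\vec{u})=\gamma(u_1,\dots,u_t,u_t,\dots,u_t)$ for $\vec{u}\in V^t$. $\mathcal{C}_m$ is counting logic (first-order logic with counting quantifiers $\exists^{n}x$, "there are at least $n$ elements $x$") restricted to at most $m$ variables. A formula $\phi(\vec{z})$ distinguishes $(\mathfrak{A},\vec{z}\mapsto\vec{u})$ from $(\mathfrak{A},\vec{z}\mapsto\vec{v})$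 if it holds under exactly one of the two assignments. Let $\mathbb{F}$ be the prime field of characteristic $c$. For a labelled partition $\gamma$ of $V^k$, $\vec{v}\in V^k$, $\vec{i}\in[k]^{(2)}$ (pairs of distinct indices), the $(\vec{i},\vec{v})$-character vector is $(\chi_\sigma)_{\sigma\in\mathrm{im}(\gamma)}$, $\chi_\sigma$ the $V\times V$ $0/1$ matrix with $(x,y)$-entry $1$ iff $\gamma(\vec{v}')=\sigma$ where $\vec{v}'$ is $\vec{v}$ with $x$ in position $i_1$ and $y$ in position $i_2$. $\mathfrak{P}_V(\mathbb{F})$ is the set of $V\times V$ matrices over $\mathbb{F}$ with all row and column sums $1$; two such character vectors $(\chi_\sigma),(\xi_\sigma)$ are $\sim_{\mathrm{sol}}$-equivalent if there is $S\in\mathfrak{P}_V(\mathbb{F})$ with $\chi_\sigma S=S\xi_\sigma$ for all $\sigma$. $\mathrm{Sol}_{k,1}^c\circ\gamma(\vec{v})=(\gamma(\vec{v}),([\text{$(\vec{i},\vec{v})$-character vector}]_{\sim_{\mathrm{sol}}})_{\vec{i}\in[k]^{(2)}})$. $[\alpha]^{R}$ denotes the result of iterating $X^0=\alpha$, $X^{j+1}=R\circ X^j$ until the induced equivalence relation stabilises. -}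

module Defs where

open import Data.Nat using (ℕ; zero; suc; _+_; _*_; _∸_; _≤_; _<_; s≤s; z≤n)
open import Data.Nat.Properties using (_<?_)
import Data.Nat.Properties as ℕP
open import Data.Nat.DivMod using (_mod_)
open import Data.Fin using (Fin; toℕ; fromℕ<; fromℕ)
import Data.Fin.Properties as FinP
open import Data.Bool using (Bool; true; false; if_then_else_)
open import Data.Rational using (ℚ; 0ℚ; 1ℚ) renaming (_+_ to _+ℚ_; _*_ to _*ℚ_)
open import Data.Product using (Σ; ∃; _×_; _,_)
open import Data.Sum using (_⊎_)
open import Relation.Nullary using (¬_; yes; no; Dec)
open import Relation.Nullary.Decidable using (⌊_⌋)
open import Relation.Binary.PropositionalEquality using (_≡_; _≢_)
open import Function.Bundles using (_⇔_)
open import Function.Definitions using (Injective)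

-- Graphs: finite relational structures with universe V = Fin n over a
-- finite vocabulary Fin r of binary relation symbols.

Graph : (r n : ℕ) → Set
Graph r n = Fin r → Fin n → Fin n → Bool

Tuple : ℕ → ℕ → Set
Tuple n k = Fin k → Fin n

LabelledPartition : ℕ → ℕ → Set
LabelledPartition n k = Tuple n k → ℕ

Ker : ∀ {n k} → LabelledPartition n k → Tuple n k → Tuple n k → Set
Ker γ u w = γ u ≡ γ w

SameKer : ∀ {n k} → LabelledPartition n k → LabelledPartition n k → Set
SameKer γ δ = ∀ u w → Ker γ u w ⇔ Ker δ u w

PartialIso : ∀ {r n k} → Graph r n → Tuple n k → Tuple n k → Set
PartialIso {r} {n} {k} Γ u w =
  (∀ (i j : Fin k) → u i ≡ u j → w i ≡ w j) ×
  (∀ (i j : Fin k) → w i ≡ w j → u i ≡ u j) ×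
  (∀ (R : Fin r) (i j : Fin k) → Γ R (u i) (u j) ≡ Γ R (w i) (w j))

IsAtomicTypePartition : ∀ {r n k} → Graph r n → LabelledPartition n k → Set
IsAtomicTypePartition Γ α = ∀ u w → (α u ≡ α w) ⇔ PartialIso Γ u w

-- Arithmetic of the prime field F of characteristic c:
--   c = 0      : ℚ
--   c = suc m  : ℤ/cℤ, represented by Fin c with arithmetic mod c
-- (for c prime this is the prime field F_c).

record FieldOps : Set₁ where
  field
    Carrier : Set
    0F 1F   : Carrier
    _+F_ _*F_ : Carrier → Carrier → Carrier

ℚ-ops : FieldOps
ℚ-ops = record { Carrier = ℚ ; 0F = 0ℚ ; 1F = 1ℚ ; _+F_ = _+ℚ_ ; _*F_ = _*ℚ_ }

Zmod-ops : (m : ℕ) → FieldOps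
Zmod-ops m = record
  { Carrier = Fin (suc m)
  ; 0F = 0 mod suc m
  ; 1F = 1 mod suc m
  ; _+F_ = λ a b → (toℕ a + toℕ b) mod suc m
  ; _*F_ = λ a b → (toℕ a * toℕ b) mod suc m
  }

𝔽 : ℕ → FieldOps
𝔽 zero    = ℚ-ops
𝔽 (suc m) = Zmod-ops m

module Matrices (F : FieldOps) where
  open FieldOps F

  ∑ : ∀ {n} → (Fin n → Carrier) → Carrier
  ∑ {zero}  f = 0F
  ∑ {suc n} f = f Fin.zero +F ∑ (λ i → f (Fin.suc i))
    where import Data.Fin as Fin

  Mat : ℕ → Set
  Mat n = Fin n → Fin n → Carrier

  _⊛_ : ∀ {n} → Mat n → Mat n → Mat n
  (A ⊛ B) x z = ∑ (λ y → A x y *F B y z)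

  IsInP : ∀ {n} → Mat n → Set
  IsInP S = (∀ x → ∑ (λ y → S x y) ≡ 1F) × (∀ y → ∑ (λ x → S x y) ≡ 1F)

  bit : Bool → Carrier
  bit b = if b then 1F else 0F

subst₂ : ∀ {n k} → Tuple n k → Fin k → Fin k → Fin n → Fin n → Tuple n k
subst₂ v i₁ i₂ x y j with j FinP.≟ i₁
... | yes _ = x
... | no _ with j FinP.≟ i₂
...   | yes _ = y
...   | no _ = v j

InIm : ∀ {n k} → LabelledPartition n k → ℕ → Set
InIm γ σ = ∃ λ t → γ t ≡ σ

module Sol (c : ℕ) where
  open Matrices (𝔽 c) public

  charVec : ∀ {n k} → LabelledPartition n k → Fin k → Fin k → Tuple n k → ℕ → Mat n
  charVec γ i₁ i₂ v σ x y = bit ⌊ γ (subst₂ v i₁ i₂ x y) ℕP.≟ σ ⌋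

  SolEquiv : ∀ {n k} → LabelledPartition n k → (ℕ → Mat n) → (ℕ → Mat n) → Set
  SolEquiv {n} γ χ ξ =
    Σ (Mat n) λ S → IsInP S × (∀ σ → InIm γ σ → (χ σ ⊛ S) ≡ (S ⊛ ξ σ))

  IsSolStep : ∀ {n k} → LabelledPartition n k → LabelledPartition n k → Set
  IsSolStep {n} {k} γ δ = ∀ v w →
    (δ v ≡ δ w) ⇔
    ((γ v ≡ γ w) ×
     (∀ (i₁ i₂ : Fin k) → i₁ ≢ i₂ →
        SolEquiv γ (charVec γ i₁ i₂ v) (charVec γ i₁ i₂ w)))

-- γ = [α_{k,Γ}]^{Sol_{k,1}^c}: X is the iteration sequence (X 0 = α,
-- X (j+1) = Sol ∘ X j, up to relabelling), J the first index at which the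
-- induced equivalence relation stabilises, and γ = X J.
IsSolClosure : ∀ {r n k} → ℕ → Graph r n → LabelledPartition n k → Set
IsSolClosure {r} {n} {k} c Γ γ =
  Σ (ℕ → LabelledPartition n k) λ X → Σ ℕ λ J →
    IsAtomicTypePartition Γ (X 0) ×
    (∀ j → Sol.IsSolStep c (X j) (X (suc j))) ×
    SameKer (X (suc J)) (X J) ×
    (∀ j → j < J → ¬ SameKer (X (suc j)) (X j)) ×
    (∀ u → γ u ≡ X J u)

-- Projection pr_t γ (u) = γ(u_1,…,u_t,u_t,…,u_t), t ≥ 1

pad : ∀ {n t k} → 1 ≤ t → (Fin t → Fin n) → Tuple n k
pad {t = suc t'} (s≤s _) u i with toℕ i <? suc t'
... | yes p = u (fromℕ< p)
... | no _  = u (fromℕ t')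

pr : ∀ {n k} (t : ℕ) → 1 ≤ t → LabelledPartition n k → (Fin t → Fin n) → ℕ
pr t 1≤t γ u = γ (pad 1≤t u)

3≤k⇒1≤k∸1 : ∀ {k} → 3 ≤ k → 1 ≤ k ∸ 1
3≤k⇒1≤k∸1 (s≤s (s≤s _)) = s≤s z≤n

-- Counting logic with m variables z_0 … z_{m-1} over the vocabulary.
-- Form false m : first-order formulas; Form true m : C_m formulas.

data Form (r : ℕ) : Bool → ℕ → Set where
  eq    : ∀ {b m} → Fin m → Fin m → Form r b m
  rel   : ∀ {b m} → Fin r → Fin m → Fin m → Form r b m
  neg   : ∀ {b m} → Form r b m → Form r b m
  and   : ∀ {b m} → Form r b m → Form r b m → Form r b m
  ex    : ∀ {b m} → Fin m → Form r b m → Form r b m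
  exAtLeast : ∀ {m} → ℕ → Fin m → Form r true m → Form r true m

update : ∀ {n m} → (Fin m → Fin n) → Fin m → Fin n → Fin m → Fin n
update s i a j with j FinP.≟ i
... | yes _ = a
... | no _  = s j

Sat : ∀ {r n b m} → Graph r n → (Fin m → Fin n) → Form r b m → Set
Sat Γ s (eq i j)      = s i ≡ s j
Sat Γ s (rel R i j)   = Γ R (s i) (s j) ≡ true
Sat Γ s (neg φ)       = ¬ Sat Γ s φ
Sat Γ s (and φ ψ)     = Sat Γ s φ × Sat Γ s ψ
Sat {n = n} Γ s (ex i φ) = Σ (Fin n) λ a → Sat Γ (update s i a) φ
Sat {n = n} Γ s (exAtLeast N i φ) =
  Σ (Fin N → Fin n) λ f → Injective _≡_ _≡_ f × (∀ j → Sat Γ (update s i (f j)) φ)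

Distinguishes : ∀ {r n b m} → Graph r n → Form r b m → (Fin m → Fin n) → (Fin m → Fin n) → Set
Distinguishes Γ φ u v = (Sat Γ u φ × ¬ Sat Γ v φ) ⊎ (¬ Sat Γ u φ × Sat Γ v φ)

-- Let G be the stable colouring of k-tuples, and encode an assignment to the k-1
-- variables by the k-tuple repeating the last variable.  By induction on formulas,
-- tuples of equal colour encode assignments satisfying the same formulas.  Equal
-- colours give partial isomorphisms, settling atomic formulas.  For a quantifier on
-- z_i, stability gives χ S = S ξ for the character matrices of the position pair
-- (i, last), with S having row and column sums 1.  As G sees that the last two entries
-- of an encoding agree, row x of χ has its only possible 1 at the encoding of the
-- extension by x.  So a colour of an extension on one side that is not realised on the
-- other would make a row of S vanish; and over ℚ, summing all entries of χ S = S ξ shows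
-- that each colour is realised by equally many extensions on both sides, as counting
-- quantifiers require.

module Submission where

open import Defs
open import Level using (0ℓ)
open import Algebra.Bundles using (Semiring; Ring)
import Algebra.Properties.CommutativeMonoid.Sum as CommutativeMonoidSum
import Algebra.Properties.Semiring.Sum as SemiringSum
import Algebra.Properties.Group as GroupProperties
open import Data.Nat using (ℕ; zero; suc; _≤_; _<_; _∸_; s≤s; z≤n; NonZero)
import Data.Nat.Properties as ℕP
open import Data.Nat.Properties using (_≟_)
open import Data.Nat.DivMod using (_mod_; m<n⇒m%n≡m)
open import Data.Nat.Primality using (Prime; ¬prime[1])
open import Data.Fin using (Fin; toℕ; fromℕ; inject₁; punchIn; punchOut)
  renaming (zero to fzero; suc to fsuc)
import Data.Fin.Properties as FinP
open import Data.Bool using (Bool; true; false; if_then_else_)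
open import Data.Rational using (ℚ; 0ℚ; 1ℚ) renaming (_+_ to _+ℚ_; _≤_ to _≤ℚ_; _<_ to _<ℚ_)
import Data.Rational.Properties as ℚP
open import Algebra.Properties.Monoid.Mult ℚP.+-0-monoid using () renaming (_×_ to _×ℚ_)
open import Data.Product using (Σ; ∃; _×_; _,_; proj₁; proj₂)
open import Data.Sum using (_⊎_; inj₁; inj₂)
open import Function using (_∘_)
open import Function.Bundles using (Equivalence)
open import Function.Definitions using (Injective)
open import Relation.Nullary using (¬_; Dec; yes; no; contradiction)
open import Relation.Nullary.Decidable using (⌊_⌋; dec-true; dec-false; isYes≗does)
open import Relation.Binary.PropositionalEquality
  using (_≡_; _≢_; refl; sym; trans; cong; cong₂; cong-app; subst; module ≡-Reasoning)

⌊⌋-true : ∀ {A : Set} (a? : Dec A) → A → ⌊ a? ⌋ ≡ true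
⌊⌋-true a? a = trans (isYes≗does a?) (dec-true a? a)

⌊⌋-false : ∀ {A : Set} (a? : Dec A) → ¬ A → ⌊ a? ⌋ ≡ false
⌊⌋-false a? ¬a = trans (isYes≗does a?) (dec-false a? ¬a)

record ZeroOneLaws (F : FieldOps) : Set where
  open FieldOps F
  field
    +-identityˡ : ∀ a → 0F +F a ≡ a
    +-identityʳ : ∀ a → a +F 0F ≡ a
    zeroˡ       : ∀ a → 0F *F a ≡ 0F
    zeroʳ       : ∀ a → a *F 0F ≡ 0F
    *-identityˡ : ∀ a → 1F *F a ≡ a
    1≢0         : 1F ≢ 0F

ℚ-zeroOneLaws : ZeroOneLaws ℚ-ops
ℚ-zeroOneLaws = record
  { +-identityˡ = ℚP.+-identityˡ
  ; +-identityʳ = ℚP.+-identityʳ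
  ; zeroˡ       = ℚP.*-zeroˡ
  ; zeroʳ       = ℚP.*-zeroʳ
  ; *-identityˡ = ℚP.*-identityˡ
  ; 1≢0         = λ ()
  }

toℕ-mod : ∀ {d} .{{_ : NonZero d}} (a : Fin d) → toℕ a mod d ≡ a
toℕ-mod a = FinP.toℕ-injective (trans (FinP.toℕ-fromℕ< _) (m<n⇒m%n≡m (FinP.toℕ<n a)))

Zmod-zeroOneLaws : ∀ m → ZeroOneLaws (Zmod-ops (suc m))
Zmod-zeroOneLaws m = record
  { +-identityˡ = toℕ-mod
  ; +-identityʳ = λ a → trans (cong (_mod d) (ℕP.+-identityʳ (toℕ a))) (toℕ-mod a)
  ; zeroˡ       = λ _ → refl
  ; zeroʳ       = λ a → cong (_mod d) (ℕP.*-zeroʳ (toℕ a))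
  ; *-identityˡ = λ a → trans (cong (_mod d) (ℕP.+-identityʳ (toℕ a))) (toℕ-mod a)
  ; 1≢0         = λ ()
  }
  where d = suc (suc m)

-- 𝔽 1 is the zero ring; the primality hypothesis excludes it.
𝔽-zeroOneLaws : ∀ c → c ≡ 0 ⊎ Prime c → ZeroOneLaws (𝔽 c)
𝔽-zeroOneLaws zero          _              = ℚ-zeroOneLaws
𝔽-zeroOneLaws (suc zero)    (inj₁ ())
𝔽-zeroOneLaws (suc zero)    (inj₂ 1-prime) = contradiction 1-prime ¬prime[1]
𝔽-zeroOneLaws (suc (suc m)) _              = Zmod-zeroOneLaws m

module ZeroOneSums {F : FieldOps} (laws : ZeroOneLaws F) where
  open FieldOps F
  open Matrices F using (∑)
  open ZeroOneLaws laws

  ∑-zero : ∀ {n} (f : Fin n → Carrier) → (∀ x → f x ≡ 0F) → ∑ f ≡ 0F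
  ∑-zero {zero}  f _   = refl
  ∑-zero {suc n} f f≡0 =
    trans (cong₂ _+F_ (f≡0 fzero) (∑-zero (f ∘ fsuc) (f≡0 ∘ fsuc))) (+-identityˡ 0F)

  ∑-single : ∀ {n} (f : Fin n → Carrier) x → (∀ y → y ≢ x → f y ≡ 0F) → ∑ f ≡ f x
  ∑-single {suc n} f fzero    others =
    trans (cong (f fzero +F_) (∑-zero (f ∘ fsuc) (λ y → others (fsuc y) λ ())))
          (+-identityʳ (f fzero))
  ∑-single {suc n} f (fsuc x) others =
    trans (cong (_+F ∑ (f ∘ fsuc)) (others fzero λ ()))
          (trans (+-identityˡ _)
                 (∑-single (f ∘ fsuc) x λ y y≢x → others (fsuc y) (y≢x ∘ FinP.suc-injective)))

opsOf : ∀ {ℓ} → Semiring 0ℓ ℓ → FieldOps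
opsOf R = record { Carrier = Carrier ; 0F = 0# ; 1F = 1# ; _+F_ = _+_ ; _*F_ = _*_ }
  where open Semiring R

module StochasticSums {ℓ} (R : Semiring 0ℓ ℓ) where
  open Semiring R using (Carrier; _≈_; _+_; _*_; 1#; setoid; *-congˡ; *-congʳ; *-identityˡ; *-identityʳ)
  module R = Semiring R
  open Matrices (opsOf R) using (∑; Mat; _⊛_)
  open SemiringSum R using (sum; sum-cong-≗; sum-cong-≋; ∑-comm; *-distribˡ-sum; *-distribʳ-sum)
  open import Relation.Binary.Reasoning.Setoid setoid

  ∑≡sum : ∀ {n} (f : Fin n → Carrier) → ∑ f ≡ sum f
  ∑≡sum {zero}  f = refl
  ∑≡sum {suc n} f = cong (f fzero +_) (∑≡sum (f ∘ fsuc))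

  ∑-cong : ∀ {n} {f g : Fin n → Carrier} → (∀ x → f x ≡ g x) → ∑ f ≡ ∑ g
  ∑-cong {f = f} {g} f≗g = trans (∑≡sum f) (trans (sum-cong-≗ f≗g) (sym (∑≡sum g)))

  total : ∀ {n} → Mat n → Carrier
  total A = ∑ λ x → ∑ λ y → A x y

  total≡sum : ∀ {n} (A : Mat n) → total A ≡ sum λ x → sum λ y → A x y
  total≡sum A = trans (∑≡sum λ x → ∑ (A x)) (sum-cong-≗ λ x → ∑≡sum (A x))

  total-⊛-rowStochastic : ∀ {n} (A S : Mat n) → (∀ y → ∑ (S y) ≈ 1#) → total (A ⊛ S) ≈ total A
  total-⊛-rowStochastic A S rows = begin
    total (A ⊛ S)                                 ≡⟨ total≡sum (A ⊛ S) ⟩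
    sum (λ x → sum λ z → ∑ λ y → A x y * S y z)   ≡⟨ sum-cong-≗ (λ x → sum-cong-≗ λ z → ∑≡sum λ y → A x y * S y z) ⟩
    sum (λ x → sum λ z → sum λ y → A x y * S y z) ≈⟨ sum-cong-≋ (λ x → ∑-comm λ z y → A x y * S y z) ⟩
    sum (λ x → sum λ y → sum λ z → A x y * S y z) ≈⟨ sum-cong-≋ (λ x → sum-cong-≋ λ y →
                                                        R.sym (*-distribˡ-sum (A x y) (S y))) ⟩
    sum (λ x → sum λ y → A x y * sum (S y))       ≈⟨ sum-cong-≋ (λ x → sum-cong-≋ λ y →
                                                        R.trans (*-congˡ (R.trans (R.reflexive (sym (∑≡sum (S y))))
                                                                              (rows y)))
                                                              (*-identityʳ (A x y))) ⟩
    sum (λ x → sum λ y → A x y)                   ≡⟨ total≡sum A ⟨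
    total A                                       ∎

  total-⊛-colStochastic : ∀ {n} (S B : Mat n) → (∀ y → ∑ (λ x → S x y) ≈ 1#) → total (S ⊛ B) ≈ total B
  total-⊛-colStochastic S B cols = begin
    total (S ⊛ B)                                 ≡⟨ total≡sum (S ⊛ B) ⟩
    sum (λ x → sum λ z → ∑ λ y → S x y * B y z)   ≡⟨ sum-cong-≗ (λ x → sum-cong-≗ λ z → ∑≡sum λ y → S x y * B y z) ⟩
    sum (λ x → sum λ z → sum λ y → S x y * B y z) ≈⟨ ∑-comm (λ x z → sum λ y → S x y * B y z) ⟩
    sum (λ z → sum λ x → sum λ y → S x y * B y z) ≈⟨ sum-cong-≋ (λ z → ∑-comm λ x y → S x y * B y z) ⟩
    sum (λ z → sum λ y → sum λ x → S x y * B y z) ≈⟨ sum-cong-≋ (λ z → sum-cong-≋ λ y →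
                                                        R.sym (*-distribʳ-sum (B y z) (λ x → S x y))) ⟩
    sum (λ z → sum λ y → sum (λ x → S x y) * B y z) ≈⟨ sum-cong-≋ (λ z → sum-cong-≋ λ y →
                                                        R.trans (*-congʳ (R.trans (R.reflexive (sym (∑≡sum λ x → S x y)))
                                                                              (cols y)))
                                                              (*-identityˡ (B y z))) ⟩
    sum (λ z → sum λ y → B y z)                   ≈⟨ ∑-comm (λ z y → B y z) ⟩
    sum (λ y → sum λ z → B y z)                   ≡⟨ total≡sum B ⟨
    total B                                       ∎

module Counting where
  open import Data.Nat using (_+_)
  open CommutativeMonoidSum ℕP.+-0-commutativeMonoid using (sum; sum-cong-≗; sum-replicate-zero; sum-remove)
  open ≡-Reasoning

  count : ∀ {n} → (Fin n → Bool) → ℕ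
  count P = sum λ x → if P x then 1 else 0

  count-remove : ∀ {n} (P : Fin (suc n) → Bool) x → count P ≡ (if P x then 1 else 0) + count (P ∘ punchIn x)
  count-remove P x = sum-remove {i = x} λ y → if P y then 1 else 0

  fibre : ∀ {n} → (Fin n → ℕ) → ℕ → ℕ
  fibre col σ = count λ x → ⌊ col x ≟ σ ⌋

  SameFibres : ∀ {n} → (Fin n → ℕ) → (Fin n → ℕ) → Set
  SameFibres col col' = ∀ σ → fibre col σ ≡ fibre col' σ

  fibre-empty : ∀ {n} (col : Fin n → ℕ) σ → ¬ (∃ λ x → col x ≡ σ) → fibre col σ ≡ 0
  fibre-empty {n} col σ ∉ = trans (sum-cong-≗ λ x → cong (if_then 1 else 0) (⌊⌋-false (col x ≟ σ) (∉ ∘ (x ,_))))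
                                  (sum-replicate-zero n)

  fibre-witness : ∀ {n} (col : Fin n → ℕ) σ → fibre col σ ≢ 0 → ∃ λ x → col x ≡ σ
  fibre-witness col σ nonempty with FinP.any? (λ x → col x ≟ σ)
  ... | yes found = found
  ... | no  ∉     = contradiction (fibre-empty col σ ∉) nonempty

  fibre-of-value : ∀ {n} (col : Fin (suc n) → ℕ) x → fibre col (col x) ≢ 0
  fibre-of-value col x empty with count-remove (λ y → ⌊ col y ≟ col x ⌋) x
  ... | split rewrite ⌊⌋-true (col x ≟ col x) refl = ℕP.1+n≢0 (trans (sym split) empty)

  sameFibres-remove : ∀ {n} (col col' : Fin (suc n) → ℕ) → SameFibres col col' →
                      ∀ x x' → col x ≡ col' x' → SameFibres (col ∘ punchIn x) (col' ∘ punchIn x')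
  sameFibres-remove col col' same x x' x∼x' σ = ℕP.+-cancelˡ-≡ (hit (col x)) _ _ (begin
    hit (col x) + fibre (col ∘ punchIn x) σ    ≡⟨ count-remove (λ y → ⌊ col y ≟ σ ⌋) x ⟨
    fibre col σ                                ≡⟨ same σ ⟩
    fibre col' σ                               ≡⟨ count-remove (λ y → ⌊ col' y ≟ σ ⌋) x' ⟩
    hit (col' x') + fibre (col' ∘ punchIn x') σ ≡⟨ cong (λ a → hit a + fibre (col' ∘ punchIn x') σ) x∼x' ⟨
    hit (col x) + fibre (col' ∘ punchIn x') σ  ∎)
    where
      hit : ℕ → ℕ
      hit a = if ⌊ a ≟ σ ⌋ then 1 else 0

  -- Match f 0 with a point of the same colour under col', remove both points and recurse.
  fibre-preserving-injection : ∀ {N n} (col col' : Fin n → ℕ) → SameFibres col col' →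
    (f : Fin N → Fin n) → Injective _≡_ _≡_ f →
    ∃ λ g → Injective _≡_ _≡_ g × (∀ j → col' (g j) ≡ col (f j))
  fibre-preserving-injection {zero} _ _ _ _ _ = (λ ()) , (λ {x} → λ {}) , λ ()
  fibre-preserving-injection {suc N} {zero} _ _ _ f _ = contradiction (f fzero) FinP.¬Fin0
  fibre-preserving-injection {suc N} {suc n} col col' same f f-inj = g , g-inj , g-col
    where
      x₀ = f fzero
      matched : ∃ λ x₀' → col' x₀' ≡ col x₀
      matched = fibre-witness col' (col x₀) (subst (_≢ 0) (same (col x₀)) (fibre-of-value col x₀))
      x₀' = proj₁ matched
      avoids : ∀ j → x₀ ≢ f (fsuc j)
      avoids j = FinP.0≢1+n ∘ f-inj
      f' : Fin N → Fin n
      f' j = punchOut (avoids j)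
      f'-inj : Injective _≡_ _≡_ f'
      f'-inj e = FinP.suc-injective (f-inj (FinP.punchOut-injective (avoids _) (avoids _) e))
      rest = fibre-preserving-injection (col ∘ punchIn x₀) (col' ∘ punchIn x₀')
               (sameFibres-remove col col' same x₀ x₀' (sym (proj₂ matched))) f' f'-inj
      g' = proj₁ rest
      g : Fin (suc N) → Fin (suc n)
      g fzero    = x₀'
      g (fsuc j) = punchIn x₀' (g' j)
      g-inj : Injective _≡_ _≡_ g
      g-inj {fzero}  {fzero}  _ = refl
      g-inj {fzero}  {fsuc j} e = contradiction (sym e) (FinP.punchInᵢ≢i x₀' (g' j))
      g-inj {fsuc i} {fzero}  e = contradiction e (FinP.punchInᵢ≢i x₀' (g' i))
      g-inj {fsuc i} {fsuc j} e = cong fsuc (proj₁ (proj₂ rest) (FinP.punchIn-injective x₀' _ _ e))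
      g-col : ∀ j → col' (g j) ≡ col (f j)
      g-col fzero    = proj₂ matched
      g-col (fsuc j) = trans (proj₂ (proj₂ rest) j) (cong col (FinP.punchIn-punchOut (avoids j)))

open Counting

module RationalCounts where
  open GroupProperties ℚP.+-0-group using (∙-cancelˡ)
  open Sol 0 using (∑; bit)

  mutual
    0≤×1 : ∀ n → 0ℚ ≤ℚ n ×ℚ 1ℚ
    0≤×1 zero    = ℚP.≤-refl
    0≤×1 (suc n) = ℚP.<⇒≤ (0<suc×1 n)

    0<suc×1 : ∀ n → 0ℚ <ℚ suc n ×ℚ 1ℚ
    0<suc×1 n = ℚP.+-mono-<-≤ (ℚP.positive⁻¹ 1ℚ) (0≤×1 n)

  ×1-injective : ∀ m n → m ×ℚ 1ℚ ≡ n ×ℚ 1ℚ → m ≡ n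
  ×1-injective zero    zero    _ = refl
  ×1-injective zero    (suc n) e = contradiction e (ℚP.<⇒≢ (0<suc×1 n))
  ×1-injective (suc m) zero    e = contradiction (sym e) (ℚP.<⇒≢ (0<suc×1 m))
  ×1-injective (suc m) (suc n) e = cong suc (×1-injective m n (∙-cancelˡ 1ℚ _ _ e))

  ∑-bit : ∀ {n} (P : Fin n → Bool) → ∑ (λ x → bit (P x)) ≡ count P ×ℚ 1ℚ
  ∑-bit {zero}  P = refl
  ∑-bit {suc n} P with P fzero
  ... | true  = cong (1ℚ +ℚ_) (∑-bit (P ∘ fsuc))
  ... | false = trans (ℚP.+-identityˡ _) (∑-bit (P ∘ fsuc))

open RationalCounts

module _ {n k : ℕ} where

  subst₂-at₁ : ∀ (v : Tuple n k) i₁ i₂ x y → subst₂ v i₁ i₂ x y i₁ ≡ x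
  subst₂-at₁ v i₁ i₂ x y with i₁ FinP.≟ i₁
  ... | yes _     = refl
  ... | no  i₁≢i₁ = contradiction refl i₁≢i₁

  subst₂-at₂ : ∀ (v : Tuple n k) {i₁ i₂} x y → i₁ ≢ i₂ → subst₂ v i₁ i₂ x y i₂ ≡ y
  subst₂-at₂ v {i₁} {i₂} x y i₁≢i₂ with i₂ FinP.≟ i₁
  ... | yes i₂≡i₁ = contradiction (sym i₂≡i₁) i₁≢i₂
  ... | no  _ with i₂ FinP.≟ i₂
  ...   | yes _     = refl
  ...   | no  i₂≢i₂ = contradiction refl i₂≢i₂

  subst₂-other : ∀ (v : Tuple n k) i₁ i₂ x y {j} → j ≢ i₁ → j ≢ i₂ → subst₂ v i₁ i₂ x y j ≡ v j
  subst₂-other v i₁ i₂ x y {j} j≢i₁ j≢i₂ with j FinP.≟ i₁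
  ... | yes j≡i₁ = contradiction j≡i₁ j≢i₁
  ... | no  _ with j FinP.≟ i₂
  ...   | yes j≡i₂ = contradiction j≡i₂ j≢i₂
  ...   | no  _    = refl

-- An assignment s of the variables z_0 … z_m is encoded by the (m+2)-tuple
-- (s 0, …, s m, s m), as in pr_{k-1}; the last position duplicates z_m.
module Encoding {n m : ℕ} where

  Assignment : Set
  Assignment = Fin (suc m) → Fin n

  lastPos : Fin (suc (suc m))
  lastPos = fromℕ (suc m)

  lastVar : Fin (suc m)
  lastVar = fromℕ m

  inject₁≢lastPos : ∀ i → inject₁ i ≢ lastPos
  inject₁≢lastPos i = FinP.fromℕ≢inject₁ ∘ sym

  record Encodes (w : Tuple n (suc (suc m))) (s : Assignment) : Set where
    constructor encodes
    field
      vars : ∀ i → w (inject₁ i) ≡ s i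
      last : w lastPos ≡ s lastVar

  Twin : Tuple n (suc (suc m)) → Set
  Twin w = w lastPos ≡ w (inject₁ lastVar)

  encodes⇒twin : ∀ {w s} → Encodes w s → Twin w
  encodes⇒twin (encodes vars last) = trans last (sym (vars lastVar))

  pad-encodes : ∀ (u : Assignment) → Encodes (pad (s≤s z≤n) u) u
  pad-encodes u = encodes pad-var pad-last
    where
      pad-var : ∀ i → pad (s≤s z≤n) u (inject₁ i) ≡ u i
      pad-var i with toℕ (inject₁ i) ℕP.<? suc m
      ... | yes i<m = cong u (FinP.toℕ-injective (trans (FinP.toℕ-fromℕ< i<m) (FinP.toℕ-inject₁ i)))
      ... | no  i≮m = contradiction (subst (_< suc m) (sym (FinP.toℕ-inject₁ i)) (FinP.toℕ<n i)) i≮m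
      pad-last : pad (s≤s z≤n) u lastPos ≡ u lastVar
      pad-last with toℕ lastPos ℕP.<? suc m
      ... | yes last<m = contradiction (subst (_< suc m) (FinP.toℕ-fromℕ (suc m)) last<m) (ℕP.<-irrefl refl)
      ... | no  _      = refl

  extend : Tuple n (suc (suc m)) → Fin (suc m) → Fin n → Fin n → Tuple n (suc (suc m))
  extend w i x y = subst₂ w (inject₁ i) lastPos x y

  extend-vars : ∀ {w s} → Encodes w s → ∀ i x y j → extend w i x y (inject₁ j) ≡ update s i x j
  extend-vars {w} {s} (encodes vars _) i x y j with j FinP.≟ i
  ... | yes refl = subst₂-at₁ w (inject₁ j) lastPos x y
  ... | no  j≢i  = trans (subst₂-other w (inject₁ i) lastPos x y (j≢i ∘ FinP.inject₁-injective) (inject₁≢lastPos j))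
                         (vars j)

  encodeUpdate : Tuple n (suc (suc m)) → Assignment → Fin (suc m) → Fin n → Tuple n (suc (suc m))
  encodeUpdate w s i x = extend w i x (update s i x lastVar)

  encodeUpdate-encodes : ∀ {w s} → Encodes w s → ∀ i x → Encodes (encodeUpdate w s i x) (update s i x)
  encodeUpdate-encodes {w} enc i x = encodes (extend-vars enc i x _) (subst₂-at₂ w x _ (inject₁≢lastPos i))

  twin-extend : ∀ {w s} → Encodes w s → ∀ {i x y} → Twin (extend w i x y) → y ≡ update s i x lastVar
  twin-extend {w} enc {i} {x} {y} twin =
    trans (sym (subst₂-at₂ w x y (inject₁≢lastPos i))) (trans twin (extend-vars enc i x y lastVar))


record IsSolStable (c : ℕ) {r n k} (Γ : Graph r n) (G : LabelledPartition n k) : Set where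
  field
    refines-atomic : ∀ u w → G u ≡ G w → PartialIso Γ u w
    sol-fixed      : ∀ u w → G u ≡ G w → ∀ i₁ i₂ → i₁ ≢ i₂ →
                     Sol.SolEquiv c G (Sol.charVec c G i₁ i₂ u) (Sol.charVec c G i₁ i₂ w)

solClosure-stable : ∀ {c r n k} {Γ : Graph r n} {γ : LabelledPartition n k} → IsSolClosure c Γ γ →
  Σ (LabelledPartition n k) λ G → IsSolStable c Γ G × (∀ u → γ u ≡ G u)
solClosure-stable {c} {Γ = Γ} (X , J , atomic , step , stabilised , _ , γ≡XJ) = X J , stable , γ≡XJ
  where
    refines-initial : ∀ j u w → X j u ≡ X j w → X 0 u ≡ X 0 w
    refines-initial zero    u w e = e
    refines-initial (suc j) u w e = refines-initial j u w (proj₁ (Equivalence.to (step j u w) e))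

    stable : IsSolStable c Γ (X J)
    stable = record
      { refines-atomic = λ u w e → Equivalence.to (atomic u w) (refines-initial J u w e)
      ; sol-fixed      = λ u w e → proj₂ (Equivalence.to (step J u w) (Equivalence.from (stabilised u w) e))
      }

module Invariance (c : ℕ) (laws : ZeroOneLaws (𝔽 c)) {r n m : ℕ} (Γ : Graph r n)
                  (G : LabelledPartition n (suc (suc m))) (stable : IsSolStable c Γ G) where
  open Sol c
  open FieldOps (𝔽 c)
  open ZeroOneLaws laws
  open ZeroOneSums laws
  open IsSolStable stable
  open Encoding {n} {m}
  open ≡-Reasoning

  twin-invariant : ∀ {t t'} → G t ≡ G t' → Twin t → Twin t'
  twin-invariant e = proj₁ (refines-atomic _ _ e) lastPos (inject₁ lastVar)

  last-determined : ∀ {w s t} → Encodes w s → Twin t → ∀ {i x y} →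
                    G (extend w i x y) ≡ G t → y ≡ update s i x lastVar
  last-determined enc twin e = twin-extend enc (twin-invariant (sym e) twin)

  extensionMatrix : Tuple n (suc (suc m)) → Fin (suc m) → ℕ → Mat n
  extensionMatrix w i = charVec G (inject₁ i) lastPos w

  extensionMatrices-equiv : ∀ {w w'} → G w ≡ G w' → ∀ i →
                            SolEquiv G (extensionMatrix w i) (extensionMatrix w' i)
  extensionMatrices-equiv e i = sol-fixed _ _ e (inject₁ i) lastPos (inject₁≢lastPos i)

  extensionMatrix-off : ∀ {w s t} → Encodes w s → Twin t → ∀ i x y → y ≢ update s i x lastVar →
                        extensionMatrix w i (G t) x y ≡ 0F
  extensionMatrix-off {w} {t = t} enc twin i x y y≢ =
    cong bit (⌊⌋-false (G (extend w i x y) ≟ G t) (y≢ ∘ last-determined enc twin))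

  extensionMatrix-row : ∀ {w s t} → Encodes w s → Twin t → ∀ i x →
                        ∑ (extensionMatrix w i (G t) x) ≡ bit ⌊ G (encodeUpdate w s i x) ≟ G t ⌋
  extensionMatrix-row enc twin i x = ∑-single _ _ (extensionMatrix-off enc twin i x)

  -- If no extension of w' had the class of t, row x of χ S = S ξ would force row y₀ of S to vanish.
  class-realised : ∀ {w s w' s'} → Encodes w s → Encodes w' s' → G w ≡ G w' → ∀ i x →
                   ∃ λ x' → ∃ λ y' → G (extend w' i x' y') ≡ G (encodeUpdate w s i x)
  class-realised {w} {s} {w'} enc enc' e i x
    with FinP.any? (λ x' → FinP.any? λ y' → G (extend w' i x' y') ≟ G (encodeUpdate w s i x))
  ... | yes realised = realised
  ... | no  ∄ = contradiction row-sum 1≢0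
    where
      t  = encodeUpdate w s i x
      y₀ = update s i x lastVar
      twin = encodes⇒twin (encodeUpdate-encodes enc i x)
      χ = extensionMatrix w i (G t)
      ξ = extensionMatrix w' i (G t)
      equiv = extensionMatrices-equiv e i
      S = proj₁ equiv

      row-y₀ : ∀ z → S y₀ z ≡ 0F
      row-y₀ z = begin
        S y₀ z                         ≡⟨ *-identityˡ (S y₀ z) ⟨
        1F *F S y₀ z                   ≡⟨ cong (λ b → bit b *F S y₀ z) (⌊⌋-true (G t ≟ G t) refl) ⟨
        χ x y₀ *F S y₀ z               ≡⟨ ∑-single _ y₀ (λ y y≢ → trans (cong (_*F S y z)
                                            (extensionMatrix-off enc twin i x y y≢)) (zeroˡ (S y z))) ⟨
        (χ ⊛ S) x z                    ≡⟨ cong-app (cong-app (proj₂ (proj₂ equiv) (G t) (t , refl)) x) z ⟩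
        (S ⊛ ξ) x z                    ≡⟨ ∑-zero _ (λ y → trans (cong (S x y *F_)
                                            (cong bit (⌊⌋-false (G (extend w' i y z) ≟ G t) (∄ ∘ (y ,_) ∘ (z ,_)))))
                                            (zeroʳ (S x y))) ⟩
        0F                             ∎

      row-sum : 1F ≡ 0F
      row-sum = trans (sym (proj₁ (proj₁ (proj₂ equiv)) y₀)) (∑-zero (S y₀) row-y₀)

  extension-forth : ∀ {w s w' s'} → Encodes w s → Encodes w' s' → G w ≡ G w' → ∀ i x →
                    ∃ λ x' → G (encodeUpdate w s i x) ≡ G (encodeUpdate w' s' i x')
  extension-forth {w} {s} {w'} {s'} enc enc' e i x with class-realised enc enc' e i x
  ... | x' , y' , same =
    x' , sym (subst (λ y → G (extend w' i x' y) ≡ G (encodeUpdate w s i x))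
                    (last-determined enc' (encodes⇒twin (encodeUpdate-encodes enc i x)) same) same)

  classOf : Tuple n (suc (suc m)) → Assignment → Fin (suc m) → Fin n → ℕ
  classOf w s i x = G (encodeUpdate w s i x)

  ExtensionFibres : Set
  ExtensionFibres = ∀ {w s w' s'} → Encodes w s → Encodes w' s' → G w ≡ G w' → ∀ i →
                    SameFibres (classOf w s i) (classOf w' s' i)

  Invariant : ∀ {b} → Form r b (suc m) → Set
  Invariant φ = ∀ {w s w' s'} → Encodes w s → Encodes w' s' → G w ≡ G w' → Sat Γ s φ → Sat Γ s' φ

  sat-invariant : ∀ {b} → (b ≡ true → ExtensionFibres) → (φ : Form r b (suc m)) → Invariant φ
  sat-invariant _ (eq i j) {w} {s} {w'} {s'} (encodes vars _) (encodes vars' _) e si≡sj = begin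
    s' i               ≡⟨ vars' i ⟨
    w' (inject₁ i)     ≡⟨ proj₁ (refines-atomic w w' e) (inject₁ i) (inject₁ j)
                           (trans (vars i) (trans si≡sj (sym (vars j)))) ⟩
    w' (inject₁ j)     ≡⟨ vars' j ⟩
    s' j               ∎
  sat-invariant _ (rel R i j) {w} {s} {w'} {s'} (encodes vars _) (encodes vars' _) e sat = begin
    Γ R (s' i) (s' j)                      ≡⟨ cong₂ (Γ R) (vars' i) (vars' j) ⟨
    Γ R (w' (inject₁ i)) (w' (inject₁ j))  ≡⟨ proj₂ (proj₂ (refines-atomic w w' e)) R (inject₁ i) (inject₁ j) ⟨
    Γ R (w (inject₁ i)) (w (inject₁ j))    ≡⟨ cong₂ (Γ R) (vars i) (vars j) ⟩
    Γ R (s i) (s j)                        ≡⟨ sat ⟩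
    true                                   ∎
  sat-invariant fibres (neg φ) enc enc' e ¬sat sat' = ¬sat (sat-invariant fibres φ enc' enc (sym e) sat')
  sat-invariant fibres (and φ ψ) enc enc' e (sat₁ , sat₂) =
    sat-invariant fibres φ enc enc' e sat₁ , sat-invariant fibres ψ enc enc' e sat₂
  sat-invariant fibres (ex i φ) enc enc' e (x , sat) with extension-forth enc enc' e i x
  ... | x' , e' = x' , sat-invariant fibres φ (encodeUpdate-encodes enc i x) (encodeUpdate-encodes enc' i x') e' sat
  sat-invariant fibres (exAtLeast N i φ) {w} {s} {w'} {s'} enc enc' e (f , f-inj , sat)
    with fibre-preserving-injection (classOf w s i) (classOf w' s' i) (fibres refl enc enc' e i) f f-inj
  ... | g , g-inj , g-class = g , g-inj , λ j →
    sat-invariant fibres φ (encodeUpdate-encodes enc i (f j)) (encodeUpdate-encodes enc' i (g j))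
                  (sym (g-class j)) (sat j)

  invariant⇒¬distinguishes : ∀ {b} {φ : Form r b (suc m)} → Invariant φ →
    ∀ u v → G (pad (s≤s z≤n) u) ≡ G (pad (s≤s z≤n) v) → ¬ Distinguishes Γ φ u v
  invariant⇒¬distinguishes inv u v e (inj₁ (sat , ¬sat)) = ¬sat (inv (pad-encodes u) (pad-encodes v) e sat)
  invariant⇒¬distinguishes inv u v e (inj₂ (¬sat , sat)) = ¬sat (inv (pad-encodes v) (pad-encodes u) (sym e) sat)

  firstOrder-indistinguishable : ∀ (φ : Form r false (suc m)) u v →
    G (pad (s≤s z≤n) u) ≡ G (pad (s≤s z≤n) v) → ¬ Distinguishes Γ φ u v
  firstOrder-indistinguishable φ = invariant⇒¬distinguishes (sat-invariant (λ ()) φ)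

module RationalInvariance {r n m : ℕ} (Γ : Graph r n) (G : LabelledPartition n (suc (suc m)))
                          (stable : IsSolStable 0 Γ G) where
  open Sol 0 using (∑; bit; _⊛_)
  open Invariance 0 ℚ-zeroOneLaws Γ G stable
  -- opsOf (Ring.semiring ℚP.+-*-ring) is definitionally ℚ-ops = 𝔽 0.
  open StochasticSums (Ring.semiring ℚP.+-*-ring) using (∑-cong; total; total-⊛-rowStochastic; total-⊛-colStochastic)
  open Encoding {n} {m}
  open ≡-Reasoning

  fibre-as-total : ∀ {w s t} → Encodes w s → Twin t → ∀ i →
                   fibre (classOf w s i) (G t) ×ℚ 1ℚ ≡ total (extensionMatrix w i (G t))
  fibre-as-total {w} {s} {t} enc twin i = begin
    fibre (classOf w s i) (G t) ×ℚ 1ℚ              ≡⟨ ∑-bit (λ x → ⌊ classOf w s i x ≟ G t ⌋) ⟨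
    ∑ (λ x → bit ⌊ classOf w s i x ≟ G t ⌋)        ≡⟨ ∑-cong (λ x → extensionMatrix-row enc twin i x) ⟨
    total (extensionMatrix w i (G t))              ∎

  -- Summing all entries of χ S = S ξ, with S doubly stochastic, gives |χ| = |ξ|.
  fibres-agree-at : ∀ {w s w' s'} → Encodes w s → Encodes w' s' → G w ≡ G w' → ∀ i x →
    fibre (classOf w s i) (classOf w s i x) ≡ fibre (classOf w' s' i) (classOf w s i x)
  fibres-agree-at {w} {s} {w'} {s'} enc enc' e i x = ×1-injective _ _ (begin
    fibre (classOf w s i) (G t) ×ℚ 1ℚ     ≡⟨ fibre-as-total enc twin i ⟩
    total χ                               ≡⟨ total-⊛-rowStochastic χ S rows ⟨
    total (χ ⊛ S)                         ≡⟨ cong total (χS≡Sξ (G t) (t , refl)) ⟩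
    total (S ⊛ ξ)                         ≡⟨ total-⊛-colStochastic S ξ cols ⟩
    total ξ                               ≡⟨ fibre-as-total enc' twin i ⟨
    fibre (classOf w' s' i) (G t) ×ℚ 1ℚ   ∎)
    where
      t = encodeUpdate w s i x
      twin = encodes⇒twin (encodeUpdate-encodes enc i x)
      χ = extensionMatrix w i (G t)
      ξ = extensionMatrix w' i (G t)
      equiv = extensionMatrices-equiv e i
      S = proj₁ equiv
      rows = proj₁ (proj₁ (proj₂ equiv))
      cols = proj₂ (proj₁ (proj₂ equiv))
      χS≡Sξ = proj₂ (proj₂ equiv)

  extension-fibres : ExtensionFibres
  extension-fibres {w} {s} {w'} {s'} enc enc' e i σ with FinP.any? (λ x → classOf w s i x ≟ σ)
  ... | yes (x , refl) = fibres-agree-at enc enc' e i x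
  ... | no  ∉ with FinP.any? (λ x → classOf w' s' i x ≟ σ)
  ...   | yes (x , refl) = sym (fibres-agree-at enc' enc (sym e) i x)
  ...   | no  ∉' = trans (fibre-empty _ σ ∉) (sym (fibre-empty _ σ ∉'))

  counting-indistinguishable : ∀ (φ : Form r true (suc m)) u v →
    G (pad (s≤s z≤n) u) ≡ G (pad (s≤s z≤n) v) → ¬ Distinguishes Γ φ u v
  counting-indistinguishable φ = invariant⇒¬distinguishes (sat-invariant (λ _ → extension-fibres) φ)

corollary3p5 : (c : ℕ) → (c ≡ 0 ⊎ Prime c) →
    (k : ℕ) → (k≥3 : 3 ≤ k) →
    {r n : ℕ} (Γ : Graph r n) (γ : LabelledPartition n k) →
    IsSolClosure c Γ γ →
    (u v : Fin (k ∸ 1) → Fin n) →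
    pr (k ∸ 1) (3≤k⇒1≤k∸1 k≥3) γ u ≡ pr (k ∸ 1) (3≤k⇒1≤k∸1 k≥3) γ v →
    (∀ (φ : Form r false (k ∸ 1)) → ¬ Distinguishes Γ φ u v) ×
    (c ≡ 0 → ∀ (φ : Form r true (k ∸ 1)) → ¬ Distinguishes Γ φ u v)
corollary3p5 c c-ok (suc (suc (suc _))) (s≤s (s≤s (s≤s _))) Γ γ closure u v same-pr
  with solClosure-stable closure
... | G , stable , γ≡G =
    (λ φ → Invariance.firstOrder-indistinguishable c (𝔽-zeroOneLaws c c-ok) Γ G stable φ u v same-class) ,
    λ { refl φ → RationalInvariance.counting-indistinguishable Γ G stable φ u v same-class }
  where
    same-class : G (pad (s≤s z≤n) u) ≡ G (pad (s≤s z≤n) v)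
    same-class = trans (sym (γ≡G _)) (trans same-pr (γ≡G _))
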